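{- Let $p\ge 4$ be a composite integer. Then for every divisor $d$ of $p$ with $3\le d<p$, $$\Phi^*(p,d)<\begin{cases}\Phi_{even}(p), & \text{if } p \text{ is even},\\ \Phi_{odd}(p), & \text{if } p \text{ is odd}.\end{cases}$$
   Context: For a divisor $d$ of $p$ with $1<d<p$ and $k=p/d$, $\Phi^*(p,d)=\sum \binom{k}{x_1}\binom{k}{x_2}\cdots\binom{k}{x_{2d}}$, the sum taken over all integer tuples $(x_1,\ldots,x_{2d})$ with $x_1+\cdots+x_{2d}=p$ and $1\le x_r\le k-1$ for all $r$. For even $p\ge 4$, $\Phi_{even}(p):=\Phi^*(p,2)$ (which equals $\binom{2p}{p}-8\binom{3p/2}{p}+12\binom{p}{p/2}-6$). For odd $p\ge 5$, with $x=\lfloor p/2\rfloor$, $\Phi_{odd}(p):=\sum\binom{x+1}{x_1}\binom{x+1}{x_2}\binom{x}{x_3}\binom{x}{x_4}$, the sum taken over all integer tuples $(x_1,x_2,x_3,x_4)$ with $x_1+x_2+x_3+x_4=p$, $1\le x_1,x_2\le x$, and $1\le x_3,x_4\le x-1$. -}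

module Defs where

open import Data.Nat using (ℕ; zero; suc; _+_; _*_; _∸_; _≤_; _≤?_; _/_; NonZero)
open import Data.Nat.Combinatorics using (_C_)
open import Data.List using (List; []; _∷_; replicate; upTo; map)
open import Data.Nat.ListAction using (sum)
open import Data.Product using (_×_; _,_)
open import Relation.Nullary.Decidable using (⌊_⌋)
open import Data.Bool using (if_then_else_; _∧_)

inRange : ℕ → ℕ → ℕ → ℕ
inRange lo hi x = if ⌊ lo ≤? x ⌋ ∧ ⌊ x ≤? hi ⌋ then 1 else 0

-- A "slot" (n , lo , hi): the variable x ranges over lo ≤ x ≤ hi and
-- contributes the factor (n choose x).
Slot : Set
Slot = ℕ × ℕ × ℕ

-- tupleSum slots s = Σ over tuples (x_1,…,x_m) of naturals with
-- x_1+…+x_m = s and lo_r ≤ x_r ≤ hi_r, of Π_r (n_r choose x_r).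
-- (Each x_r ≤ s automatically since all x are ≥ 0.)
tupleSum : List Slot → ℕ → ℕ
tupleSum [] zero = 1
tupleSum [] (suc _) = 0
tupleSum ((n , lo , hi) ∷ rest) s =
  sum (map (λ x → inRange lo hi x * (n C x) * tupleSum rest (s ∸ x)) (upTo (suc s)))

Φ* : (p d : ℕ) → .{{NonZero d}} → ℕ
Φ* p d = tupleSum (replicate (2 * d) (k , 1 , k ∸ 1)) p
  where k = p / d

Φeven : ℕ → ℕ
Φeven p = Φ* p 2

Φodd : ℕ → ℕ
Φodd p = tupleSum ((x + 1 , 1 , x) ∷ (x + 1 , 1 , x) ∷ (x , 1 , x ∸ 1) ∷ (x , 1 , x ∸ 1) ∷ []) p
  where x = p / 2

module Submission where

-- Φ*(p,d) is the coefficient of t^p in P_k(t)^{2d}, where k = p/d and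
-- P_k(t) = (1+t)^k − 1 − t^k, while Φ_even(p) and Φ_odd(p) are the
-- coefficients of t^p in P_m^4 (p = 2m) and P_{x+1}^2 P_x^2 (p = 2x+1).
-- Coefficientwise P_k ≤ (1+t)^k, so P_k^{2d} ≤ P_k^4 (1+t)^{(2d−4)k}.  The
-- four target sizes are k + n_i with n_1 + ⋯ + n_4 = (2d−4)k, and
-- P_k (1+t)^n ≤ P_{k+n} coefficientwise, strictly at t^1 when n ≥ 1;
-- handing one factor (1+t)^{n_i} to each copy of P_k gives the strict inequality.

open import Algebra.Properties.CommutativeSemigroup using (interchange)
open import Data.List using (List; []; _∷_; foldr; map; replicate; applyUpTo; upTo; length)
open import Data.List.Properties using (map-applyUpTo; map-replicate)
open import Data.List.Relation.Binary.Pointwise using (Pointwise; []; _∷_)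
open import Data.Nat
open import Data.Nat.Combinatorics using (_C_; nC1≡n; k>n⇒nCk≡0; nCk+nC[k+1]≡[n+1]C[k+1])
open import Data.Nat.DivMod using (m≡m%n+[m/n]*n; m*n/n≡m; /-monoˡ-≤)
open import Data.Nat.Divisibility using (_∣_; divides)
open import Data.Nat.ListAction using (sum)
open import Data.Nat.Primality using (Composite)
open import Data.Nat.Properties
open import Data.Nat.Tactic.RingSolver using (solve-∀)
open import Data.Product using (_×_; _,_)
open import Function using (_∘_)
open import Relation.Binary.Definitions using (tri<; tri≈; tri>)
open import Relation.Binary.PropositionalEquality
open import Relation.Nullary using (yes; no; contradiction)

open import Defs

Seq : Set
Seq = ℕ → ℕ

private variable
  f g f′ g′ : Seq

∑ : ℕ → Seq → ℕ
∑ zero    f = 0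
∑ (suc n) f = f 0 + ∑ n (f ∘ suc)

∑-cong : ∀ n → (∀ x → x < n → f x ≡ g x) → ∑ n f ≡ ∑ n g
∑-cong zero    _ = refl
∑-cong (suc n) e = cong₂ _+_ (e 0 z<s) (∑-cong n (λ x x<n → e (suc x) (s<s x<n)))

∑-mono-≤ : ∀ n → (∀ x → x < n → f x ≤ g x) → ∑ n f ≤ ∑ n g
∑-mono-≤ zero    _  = z≤n
∑-mono-≤ (suc n) le = +-mono-≤ (le 0 z<s) (∑-mono-≤ n (λ x x<n → le (suc x) (s<s x<n)))

∑-mono-< : ∀ {i n} → i < n → (∀ x → x < n → f x ≤ g x) → f i < g i → ∑ n f < ∑ n g
∑-mono-< {i = zero}  {suc n} _ le lt =
  +-mono-<-≤ lt (∑-mono-≤ n (λ x x<n → le (suc x) (s<s x<n)))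
∑-mono-< {i = suc i} {suc n} (s<s i<n) le lt =
  +-mono-≤-< (le 0 z<s) (∑-mono-< i<n (λ x x<n → le (suc x) (s<s x<n)) lt)

term≤∑ : ∀ {i n} → i < n → f i ≤ ∑ n f
term≤∑ {i = zero}  {suc n} _         = m≤m+n _ _
term≤∑ {i = suc i} {suc n} (s<s i<n) = ≤-trans (term≤∑ i<n) (m≤n+m _ _)

∑-zero : ∀ n → ∑ n (λ _ → 0) ≡ 0
∑-zero zero    = refl
∑-zero (suc n) = ∑-zero n

∑-+ : ∀ n → ∑ n (λ x → f x + g x) ≡ ∑ n f + ∑ n g
∑-+ zero = refl
∑-+ {f} {g} (suc n) =
  trans (cong (f 0 + g 0 +_) (∑-+ n)) (interchange +-commutativeSemigroup (f 0) (g 0) _ _)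

∑-*ˡ : ∀ c n → ∑ n (λ x → c * f x) ≡ c * ∑ n f
∑-*ˡ c zero        = sym (*-zeroʳ c)
∑-*ˡ {f} c (suc n) =
  trans (cong (c * f 0 +_) (∑-*ˡ c n)) (sym (*-distribˡ-+ c (f 0) (∑ n (f ∘ suc))))

∑-swap : ∀ (F : ℕ → Seq) n m → ∑ n (λ x → ∑ m (F x)) ≡ ∑ m (λ y → ∑ n (λ x → F x y))
∑-swap F zero    m = sym (∑-zero m)
∑-swap F (suc n) m = trans (cong (∑ m (F 0) +_) (∑-swap (F ∘ suc) n m)) (sym (∑-+ m))

∑-last : ∀ n → ∑ (suc n) f ≡ ∑ n f + f n
∑-last zero        = +-comm _ 0
∑-last {f} (suc n) = trans (cong (f 0 +_) (∑-last n)) (sym (+-assoc (f 0) _ _))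

∑-reverse : ∀ n → ∑ n f ≡ ∑ n (λ x → f (n ∸ suc x))
∑-reverse zero        = refl
∑-reverse {f} (suc n) =
  trans (∑-last {f} n) (trans (cong (_+ f n) (∑-reverse {f} n)) (+-comm _ (f n)))

∑-vanishing-tail : ∀ {n m} → n ≤ m → (∀ x → n ≤ x → x < m → f x ≡ 0) → ∑ m f ≡ ∑ n f
∑-vanishing-tail {n = zero} {m} _ z =
  trans (∑-cong m (λ x x<m → z x z≤n x<m)) (∑-zero m)
∑-vanishing-tail {f} {suc n} {suc m} (s≤s n≤m) z =
  cong (f 0 +_) (∑-vanishing-tail n≤m (λ x n≤x x<m → z (suc x) (s≤s n≤x) (s<s x<m)))

inRange-≤1 : ∀ lo hi x → inRange lo hi x ≤ 1
inRange-≤1 lo hi x with lo ≤? x | x ≤? hi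
... | yes _ | yes _ = ≤-refl
... | yes _ | no  _ = z≤n
... | no  _ | _     = z≤n

inRange-inside : ∀ {lo hi x} → lo ≤ x → x ≤ hi → inRange lo hi x ≡ 1
inRange-inside {lo} {hi} {x} lo≤x x≤hi with lo ≤? x | x ≤? hi
... | yes _   | yes _    = refl
... | yes _   | no  x≰hi = contradiction x≤hi x≰hi
... | no lo≰x | _        = contradiction lo≤x lo≰x

inRange-above : ∀ {lo hi x} → hi < x → inRange lo hi x ≡ 0
inRange-above {lo} {hi} {x} hi<x with lo ≤? x | x ≤? hi
... | yes _ | yes x≤hi = contradiction x≤hi (<⇒≱ hi<x)
... | yes _ | no  _    = refl
... | no  _ | _        = refl

infixl 7 _⋆_
infix  4 _≤̇_

_⋆_ : Seq → Seq → Seq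
(f ⋆ g) s = ∑ (suc s) (λ x → f x * g (s ∸ x))

_≤̇_ : Seq → Seq → Set
f ≤̇ g = ∀ x → f x ≤ g x

⋆-cong : f ≗ f′ → g ≗ g′ → f ⋆ g ≗ f′ ⋆ g′
⋆-cong ef eg s = ∑-cong (suc s) (λ x _ → cong₂ _*_ (ef x) (eg (s ∸ x)))

⋆-mono-≤ : f ≤̇ f′ → g ≤̇ g′ → f ⋆ g ≤̇ f′ ⋆ g′
⋆-mono-≤ lf lg s = ∑-mono-≤ (suc s) (λ x _ → *-mono-≤ (lf x) (lg (s ∸ x)))

⋆-monoˡ-< : ∀ {i s} → f ≤̇ f′ → i ≤ s → f i < f′ i → 0 < g (s ∸ i) →
            (f ⋆ g) s < (f′ ⋆ g) s
⋆-monoˡ-< {g = g} {i} {s} lf i≤s lt pos =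
  ∑-mono-< (s≤s i≤s) (λ x _ → *-monoˡ-≤ (g (s ∸ x)) (lf x))
    (*-monoˡ-< (g (s ∸ i)) {{>-nonZero pos}} lt)

⋆-pos : ∀ {i s} → i ≤ s → 0 < f i → 0 < g (s ∸ i) → 0 < (f ⋆ g) s
⋆-pos {f} {g} {i} {s} i≤s pf pg =
  ≤-trans (*-mono-< pf pg) (term≤∑ {λ x → f x * g (s ∸ x)} (s≤s i≤s))

⋆-comm : ∀ f g → f ⋆ g ≗ g ⋆ f
⋆-comm f g s = trans (∑-reverse {λ x → f x * g (s ∸ x)} (suc s)) (∑-cong (suc s) swap)
  where
  swap : ∀ x → x < suc s → f (s ∸ x) * g (s ∸ (s ∸ x)) ≡ g x * f (s ∸ x)
  swap x (s≤s x≤s) = trans (cong (λ y → f (s ∸ x) * g y) (m∸[m∸n]≡n x≤s)) (*-comm (f (s ∸ x)) (g x))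

private
  -- The indicator kills the junk values h (s ∸ u) = h 0 for u > s.
  window : ℕ → Seq → Seq
  window s h u = inRange 0 s u * h (s ∸ u)

  ⋆⋆-as-double-∑ : ∀ f g h s →
    (f ⋆ (g ⋆ h)) s ≡ ∑ (suc s) (λ x → ∑ (suc s) (λ y → f x * g y * window s h (x + y)))
  ⋆⋆-as-double-∑ f g h s = ∑-cong (suc s) (λ x x<1+s → row x (≤-pred x<1+s))
    where
    term : ℕ → Seq
    term x y = f x * g y * window s h (x + y)

    inside : ∀ {x y} → x ≤ s → y ≤ s ∸ x → f x * (g y * h (s ∸ x ∸ y)) ≡ term x y
    inside {x} {y} x≤s y≤s∸x = begin
      f x * (g y * h (s ∸ x ∸ y))
        ≡⟨ *-assoc (f x) (g y) _ ⟨
      f x * g y * h (s ∸ x ∸ y)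
        ≡⟨ cong (λ u → f x * g y * h u) (∸-+-assoc s x y) ⟩
      f x * g y * h (s ∸ (x + y))
        ≡⟨ cong (f x * g y *_) (*-identityˡ _) ⟨
      f x * g y * (1 * h (s ∸ (x + y)))
        ≡⟨ cong (λ w → f x * g y * (w * h (s ∸ (x + y)))) (inRange-inside z≤n x+y≤s) ⟨
      term x y
        ∎
      where
      open ≡-Reasoning
      x+y≤s : x + y ≤ s
      x+y≤s = subst (_≤ s) (+-comm y x) (m≤o∸n⇒m+n≤o y x≤s y≤s∸x)

    outside : ∀ {x y} → s ∸ x < y → term x y ≡ 0
    outside {x} {y} s∸x<y =
      trans (cong (λ w → f x * g y * (w * h (s ∸ (x + y)))) (inRange-above {0} s<x+y))
            (*-zeroʳ (f x * g y))
      where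
      s<x+y : s < x + y
      s<x+y = ≰⇒> (λ x+y≤s → <⇒≱ s∸x<y (m+n≤o⇒m≤o∸n y (subst (_≤ s) (+-comm x y) x+y≤s)))

    row : ∀ x → x ≤ s → f x * (g ⋆ h) (s ∸ x) ≡ ∑ (suc s) (term x)
    row x x≤s = begin
      f x * (g ⋆ h) (s ∸ x)
        ≡⟨ ∑-*ˡ {λ y → g y * h (s ∸ x ∸ y)} (f x) (suc (s ∸ x)) ⟨
      ∑ (suc (s ∸ x)) (λ y → f x * (g y * h (s ∸ x ∸ y)))
        ≡⟨ ∑-cong (suc (s ∸ x)) (λ y y<1+s∸x → inside {x} {y} x≤s (≤-pred y<1+s∸x)) ⟩
      ∑ (suc (s ∸ x)) (term x)
        ≡⟨ ∑-vanishing-tail (s≤s (m∸n≤m s x)) (λ y s∸x<y _ → outside {x} {y} s∸x<y) ⟨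
      ∑ (suc s) (term x)
        ∎
      where open ≡-Reasoning

⋆-leftComm : ∀ f g h → f ⋆ (g ⋆ h) ≗ g ⋆ (f ⋆ h)
⋆-leftComm f g h s = begin
  (f ⋆ (g ⋆ h)) s
    ≡⟨ ⋆⋆-as-double-∑ f g h s ⟩
  ∑ (suc s) (λ x → ∑ (suc s) (λ y → f x * g y * window s h (x + y)))
    ≡⟨ ∑-swap (λ x y → f x * g y * window s h (x + y)) (suc s) (suc s) ⟩
  ∑ (suc s) (λ y → ∑ (suc s) (λ x → f x * g y * window s h (x + y)))
    ≡⟨ ∑-cong (suc s) (λ y _ → ∑-cong (suc s) (λ x _ → swap x y)) ⟩
  ∑ (suc s) (λ y → ∑ (suc s) (λ x → g y * f x * window s h (y + x)))
    ≡⟨ ⋆⋆-as-double-∑ g f h s ⟨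
  (g ⋆ (f ⋆ h)) s
    ∎
  where
  open ≡-Reasoning
  swap : ∀ x y → f x * g y * window s h (x + y) ≡ g y * f x * window s h (y + x)
  swap x y = cong₂ _*_ (*-comm (f x) (g y)) (cong (window s h) (+-comm x y))

⋆-assoc : ∀ f g h → f ⋆ (g ⋆ h) ≗ (f ⋆ g) ⋆ h
⋆-assoc f g h s = begin
  (f ⋆ (g ⋆ h)) s ≡⟨ ⋆-cong {f} {f} (λ _ → refl) (⋆-comm g h) s ⟩
  (f ⋆ (h ⋆ g)) s ≡⟨ ⋆-leftComm f h g s ⟩
  (h ⋆ (f ⋆ g)) s ≡⟨ ⋆-comm h (f ⋆ g) s ⟩
  ((f ⋆ g) ⋆ h) s ∎
  where open ≡-Reasoning

binom : ℕ → Seq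
binom n k = n C k

binom-pos : ∀ {n x} → x ≤ n → 0 < binom n x
binom-pos {x = zero}  _         = z<s
binom-pos {suc n} {suc x} (s≤s x≤n) =
  subst (0 <_) (nCk+nC[k+1]≡[n+1]C[k+1] n x) (≤-trans (binom-pos x≤n) (m≤m+n _ _))

⋆-identityˡ : ∀ g → binom 0 ⋆ g ≗ g
⋆-identityˡ g s = trans (cong₂ _+_ (*-identityˡ (g s)) (∑-zero s)) (+-identityʳ (g s))

binom-suc-⋆ : ∀ a g s → (binom (suc a) ⋆ g) (suc s) ≡ (binom a ⋆ g) (suc s) + (binom a ⋆ g) s
binom-suc-⋆ a g s = begin
  1 * g (suc s) + ∑ (suc s) (λ x → binom (suc a) (suc x) * g (s ∸ x))
    ≡⟨ cong (1 * g (suc s) +_) (trans (∑-cong (suc s) pascal) (∑-+ {A} {B} (suc s))) ⟩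
  1 * g (suc s) + ((binom a ⋆ g) s + ∑ (suc s) B)
    ≡⟨ cong (1 * g (suc s) +_) (+-comm _ (∑ (suc s) B)) ⟩
  1 * g (suc s) + (∑ (suc s) B + (binom a ⋆ g) s)
    ≡⟨ +-assoc (1 * g (suc s)) (∑ (suc s) B) _ ⟨
  (binom a ⋆ g) (suc s) + (binom a ⋆ g) s
    ∎
  where
  open ≡-Reasoning
  A B : Seq
  A x = binom a x * g (s ∸ x)
  B x = binom a (suc x) * g (s ∸ x)
  pascal : ∀ x → x < suc s → binom (suc a) (suc x) * g (s ∸ x) ≡ A x + B x
  pascal x _ = trans (cong (_* g (s ∸ x)) (sym (nCk+nC[k+1]≡[n+1]C[k+1] a x)))
                     (*-distribʳ-+ (g (s ∸ x)) (binom a x) _)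

binom-⋆-binom : ∀ a b → binom a ⋆ binom b ≗ binom (a + b)
binom-⋆-binom zero    b s       = ⋆-identityˡ (binom b) s
binom-⋆-binom (suc a) b zero    = refl
binom-⋆-binom (suc a) b (suc s) = begin
  (binom (suc a) ⋆ binom b) (suc s)
    ≡⟨ binom-suc-⋆ a (binom b) s ⟩
  (binom a ⋆ binom b) (suc s) + (binom a ⋆ binom b) s
    ≡⟨ cong₂ _+_ (binom-⋆-binom a b (suc s)) (binom-⋆-binom a b s) ⟩
  (a + b) C suc s + (a + b) C s
    ≡⟨ +-comm ((a + b) C suc s) _ ⟩
  (a + b) C s + (a + b) C suc s
    ≡⟨ nCk+nC[k+1]≡[n+1]C[k+1] (a + b) s ⟩
  suc (a + b) C suc s
    ∎
  where open ≡-Reasoning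

sum-applyUpTo : ∀ f n → sum (applyUpTo f n) ≡ ∑ n f
sum-applyUpTo f zero    = refl
sum-applyUpTo f (suc n) = cong (f 0 +_) (sum-applyUpTo (f ∘ suc) n)

slotSeq : Slot → Seq
slotSeq (n , lo , hi) x = inRange lo hi x * (n C x)

-- binom 0 is the unit 1, 0, 0, … of _⋆_.
prod : List Seq → Seq
prod = foldr _⋆_ (binom 0)

tupleSum≗prod : ∀ slots → tupleSum slots ≗ prod (map slotSeq slots)
tupleSum≗prod []    zero    = refl
tupleSum≗prod []    (suc s) = refl
tupleSum≗prod (slot ∷ slots) s = begin
  sum (map term (upTo (suc s)))
    ≡⟨ cong sum (map-applyUpTo (λ x → x) term (suc s)) ⟩
  sum (applyUpTo term (suc s))
    ≡⟨ sum-applyUpTo term (suc s) ⟩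
  ∑ (suc s) term
    ≡⟨ ∑-cong (suc s) (λ x _ → cong (slotSeq slot x *_) (tupleSum≗prod slots (s ∸ x))) ⟩
  (slotSeq slot ⋆ prod (map slotSeq slots)) s
    ∎
  where
  open ≡-Reasoning
  term : Seq
  term x = slotSeq slot x * tupleSum slots (s ∸ x)

-- The coefficients of P_k(t) = (1+t)^k − 1 − t^k.
innerBinom : ℕ → Seq
innerBinom k = slotSeq (k , 1 , k ∸ 1)

innerBinom≤binom : ∀ k → innerBinom k ≤̇ binom k
innerBinom≤binom k x =
  subst (innerBinom k x ≤_) (*-identityˡ (k C x)) (*-monoˡ-≤ (k C x) (inRange-≤1 1 (k ∸ 1) x))

innerBinom-inside : ∀ {k x} → 0 < x → x < k → innerBinom k x ≡ binom k x
innerBinom-inside {k} {x} 0<x x<k =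
  trans (cong (_* (k C x)) (inRange-inside 0<x (<⇒≤pred x<k))) (*-identityˡ (k C x))

innerBinom-above : ∀ {k x} → 0 < x → k ≤ x → innerBinom k x ≡ 0
innerBinom-above {k} {suc x} _ k≤x =
  cong (_* (k C suc x)) (inRange-above {1} (s≤s (∸-monoˡ-≤ 1 k≤x)))

innerBinom-pos : ∀ {k x} → 0 < x → x < k → 0 < innerBinom k x
innerBinom-pos 0<x x<k = subst (0 <_) (sym (innerBinom-inside 0<x x<k)) (binom-pos (<⇒≤ x<k))

innerBinom-⋆-binom-top : ∀ k n → (innerBinom k ⋆ binom n) (k + n) ≡ 0
innerBinom-⋆-binom-top k n = trans (∑-cong (suc (k + n)) (λ a _ → term a)) (∑-zero (suc (k + n)))
  where
  term : ∀ a → innerBinom k a * binom n (k + n ∸ a) ≡ 0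
  term zero = refl
  term a@(suc _) with a <? k
  ... | yes a<k = trans (cong (innerBinom k a *_) (k>n⇒nCk≡0 n<k+n∸a)) (*-zeroʳ (innerBinom k a))
    where
    n<k+n∸a : n < k + n ∸ a
    n<k+n∸a = subst (n <_) (sym (+-∸-comm n (<⇒≤ a<k))) (m<n+m n (m<n⇒0<n∸m a<k))
  ... | no  a≮k = cong (_* binom n (k + n ∸ a)) (innerBinom-above z<s (≮⇒≥ a≮k))

innerBinom-⋆-binom-≤-binom : ∀ k n → innerBinom k ⋆ binom n ≤̇ binom (k + n)
innerBinom-⋆-binom-≤-binom k n s =
  subst ((innerBinom k ⋆ binom n) s ≤_) (binom-⋆-binom k n s)
    (⋆-mono-≤ {g = binom n} (innerBinom≤binom k) (λ _ → ≤-refl) s)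

innerBinom-⋆-binom-≤ : ∀ k n → innerBinom k ⋆ binom n ≤̇ innerBinom (k + n)
innerBinom-⋆-binom-≤ k n zero = z≤n
innerBinom-⋆-binom-≤ k n s@(suc _) with <-cmp s (k + n)
... | tri< s<k+n _ _ =
  subst ((innerBinom k ⋆ binom n) s ≤_) (sym (innerBinom-inside z<s s<k+n))
    (innerBinom-⋆-binom-≤-binom k n s)
... | tri≈ _ s≡k+n _ =
  ≤-trans (≤-reflexive (trans (cong (innerBinom k ⋆ binom n) s≡k+n) (innerBinom-⋆-binom-top k n))) z≤n
... | tri> _ _ s>k+n =
  ≤-trans (innerBinom-⋆-binom-≤-binom k n s) (≤-trans (≤-reflexive (k>n⇒nCk≡0 s>k+n)) z≤n)

innerBinom-⋆-binom-<₁ : ∀ {k n} → 0 < k → 0 < n → (innerBinom k ⋆ binom n) 1 < innerBinom (k + n) 1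
innerBinom-⋆-binom-<₁ {k} {n} 0<k 0<n = begin-strict
  (innerBinom k ⋆ binom n) 1 ≡⟨ trans (+-identityʳ _) (*-identityʳ _) ⟩
  innerBinom k 1             ≤⟨ innerBinom≤binom k 1 ⟩
  k C 1                      ≡⟨ nC1≡n k ⟩
  k                          <⟨ m<m+n k 0<n ⟩
  k + n                      ≡⟨ nC1≡n (k + n) ⟨
  (k + n) C 1                ≡⟨ innerBinom-inside z<s (+-mono-≤ 0<k 0<n) ⟨
  innerBinom (k + n) 1       ∎
  where open ≤-Reasoning

foldr-replicate-+ : ∀ {a b} {A : Set a} {B : Set b} (_∙_ : A → B → B) m n x e →
  foldr _∙_ e (replicate (m + n) x) ≡ foldr _∙_ (foldr _∙_ e (replicate n x)) (replicate m x)
foldr-replicate-+ _∙_ zero    n x e = refl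
foldr-replicate-+ _∙_ (suc m) n x e = cong (x ∙_) (foldr-replicate-+ _∙_ m n x e)

foldr-⋆-monoʳ : ∀ fs → g ≤̇ g′ → foldr _⋆_ g fs ≤̇ foldr _⋆_ g′ fs
foldr-⋆-monoʳ []       le = le
foldr-⋆-monoʳ (f ∷ fs) le = ⋆-mono-≤ {f} {f} (λ _ → ≤-refl) (foldr-⋆-monoʳ fs le)

foldr-⋆-binom-+ : ∀ n M fs → foldr _⋆_ (binom (n + M)) fs ≗ binom n ⋆ foldr _⋆_ (binom M) fs
foldr-⋆-binom-+ n M []       s = sym (binom-⋆-binom n M s)
foldr-⋆-binom-+ n M (f ∷ fs) s =
  trans (⋆-cong {f} {f} (λ _ → refl) (foldr-⋆-binom-+ n M fs) s)
        (⋆-leftComm f (binom n) (foldr _⋆_ (binom M) fs) s)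

prod-replicate-innerBinom-≤-binom : ∀ N k → prod (replicate N (innerBinom k)) ≤̇ binom (N * k)
prod-replicate-innerBinom-≤-binom zero    k _ = ≤-refl
prod-replicate-innerBinom-≤-binom (suc N) k s =
  ≤-trans (⋆-mono-≤ (innerBinom≤binom k) (prod-replicate-innerBinom-≤-binom N k) s)
          (≤-reflexive (binom-⋆-binom k (N * k) s))

private
  peel-binom : ∀ f n S M fs →
    f ⋆ foldr _⋆_ (binom (n + S + M)) fs ≗ (f ⋆ binom n) ⋆ foldr _⋆_ (binom (S + M)) fs
  peel-binom f n S M fs s = begin
    (f ⋆ foldr _⋆_ (binom (n + S + M)) fs) s
      ≡⟨ cong (λ u → (f ⋆ foldr _⋆_ (binom u) fs) s) (+-assoc n S M) ⟩
    (f ⋆ foldr _⋆_ (binom (n + (S + M))) fs) s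
      ≡⟨ ⋆-cong {f} {f} (λ _ → refl) (foldr-⋆-binom-+ n (S + M) fs) s ⟩
    (f ⋆ (binom n ⋆ foldr _⋆_ (binom (S + M)) fs)) s
      ≡⟨ ⋆-assoc f (binom n) (foldr _⋆_ (binom (S + M)) fs) s ⟩
    ((f ⋆ binom n) ⋆ foldr _⋆_ (binom (S + M)) fs) s
      ∎
    where open ≡-Reasoning

foldr-innerBinom-≤ : ∀ k ns M →
  foldr _⋆_ (binom (sum ns + M)) (replicate (length ns) (innerBinom k))
    ≤̇ foldr _⋆_ (binom M) (map (innerBinom ∘ (k +_)) ns)
foldr-innerBinom-≤ k []       M s = ≤-refl
foldr-innerBinom-≤ k (n ∷ ns) M s = begin
  (innerBinom k ⋆ foldr _⋆_ (binom (n + sum ns + M)) (replicate (length ns) (innerBinom k))) s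
    ≡⟨ peel-binom (innerBinom k) n (sum ns) M (replicate (length ns) (innerBinom k)) s ⟩
  ((innerBinom k ⋆ binom n) ⋆ foldr _⋆_ (binom (sum ns + M)) (replicate (length ns) (innerBinom k))) s
    ≤⟨ ⋆-mono-≤ (innerBinom-⋆-binom-≤ k n) (foldr-innerBinom-≤ k ns M) s ⟩
  (innerBinom (k + n) ⋆ foldr _⋆_ (binom M) (map (innerBinom ∘ (k +_)) ns)) s
    ∎
  where open ≤-Reasoning

foldr-innerBinom-< : ∀ {k n} ns M {s} → 0 < k → 0 < n →
  0 < foldr _⋆_ (binom M) (map (innerBinom ∘ (k +_)) ns) s →
  foldr _⋆_ (binom (sum (n ∷ ns) + M)) (replicate (length (n ∷ ns)) (innerBinom k)) (suc s)
    < foldr _⋆_ (binom M) (map (innerBinom ∘ (k +_)) (n ∷ ns)) (suc s)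
foldr-innerBinom-< {k} {n} ns M {s} 0<k 0<n pos = begin-strict
  (innerBinom k ⋆ foldr _⋆_ (binom (n + sum ns + M)) (replicate (length ns) (innerBinom k))) (suc s)
    ≡⟨ peel-binom (innerBinom k) n (sum ns) M (replicate (length ns) (innerBinom k)) (suc s) ⟩
  ((innerBinom k ⋆ binom n) ⋆ foldr _⋆_ (binom (sum ns + M)) (replicate (length ns) (innerBinom k))) (suc s)
    ≤⟨ ⋆-mono-≤ {innerBinom k ⋆ binom n} (λ _ → ≤-refl) (foldr-innerBinom-≤ k ns M) (suc s) ⟩
  ((innerBinom k ⋆ binom n) ⋆ rest) (suc s)
    <⟨ ⋆-monoˡ-< {g = rest} (innerBinom-⋆-binom-≤ k n) (s≤s z≤n)
                 (innerBinom-⋆-binom-<₁ 0<k 0<n) pos ⟩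
  (innerBinom (k + n) ⋆ rest) (suc s)
    ∎
  where
  open ≤-Reasoning
  rest : Seq
  rest = foldr _⋆_ (binom M) (map (innerBinom ∘ (k +_)) ns)

prod-replicate-innerBinom-< : ∀ {k N n} ns {s} → 0 < k → 0 < n → N * k ≡ sum (n ∷ ns) →
  0 < prod (map (innerBinom ∘ (k +_)) ns) s →
  prod (replicate (length (n ∷ ns) + N) (innerBinom k)) (suc s)
    < prod (map (innerBinom ∘ (k +_)) (n ∷ ns)) (suc s)
prod-replicate-innerBinom-< {k} {N} {n} ns {s} 0<k 0<n N*k≡sum pos = begin-strict
  prod (replicate (j + N) (innerBinom k)) (suc s)
    ≡⟨ cong (λ h → h (suc s)) (foldr-replicate-+ _⋆_ j N (innerBinom k) (binom 0)) ⟩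
  foldr _⋆_ (prod (replicate N (innerBinom k))) (replicate j (innerBinom k)) (suc s)
    ≤⟨ foldr-⋆-monoʳ (replicate j (innerBinom k)) (prod-replicate-innerBinom-≤-binom N k) (suc s) ⟩
  foldr _⋆_ (binom (N * k)) (replicate j (innerBinom k)) (suc s)
    ≡⟨ cong (λ M → foldr _⋆_ (binom M) (replicate j (innerBinom k)) (suc s))
            (trans N*k≡sum (sym (+-identityʳ _))) ⟩
  foldr _⋆_ (binom (sum (n ∷ ns) + 0)) (replicate j (innerBinom k)) (suc s)
    <⟨ foldr-innerBinom-< ns 0 0<k 0<n pos ⟩
  prod (map (innerBinom ∘ (k +_)) (n ∷ ns)) (suc s)
    ∎
  where
  open ≤-Reasoning
  j = length (n ∷ ns)

prod-pos : ∀ {fs xs} → Pointwise (λ f x → 0 < f x) fs xs → 0 < prod fs (sum xs)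
prod-pos [] = z<s
prod-pos {f ∷ fs} {x ∷ xs} (0<fx ∷ rest) =
  ⋆-pos {f} {prod fs} (m≤m+n x (sum xs)) 0<fx
    (subst (λ u → 0 < prod fs u) (sym (m+n∸m≡n x (sum xs))) (prod-pos rest))

2*m<m*n : ∀ {m n} → 0 < m → 3 ≤ n → 2 * m < m * n
2*m<m*n {m} {n} 0<m 3≤n = begin-strict
  2 * m <⟨ *-monoˡ-< m {{>-nonZero 0<m}} (n<1+n 2) ⟩
  3 * m ≤⟨ *-monoˡ-≤ m 3≤n ⟩
  n * m ≡⟨ *-comm n m ⟩
  m * n ∎
  where open ≤-Reasoning

cofactor-pos : ∀ {k d p} → 0 < p → p ≡ k * d → 0 < k
cofactor-pos {suc _} _  _    = z<s
cofactor-pos {zero}  () refl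

cofactor<half : ∀ {k d m} → 0 < k → 3 ≤ d → 2 * m ≡ k * d → k < m
cofactor<half {k} {d} {m} 0<k 3≤d 2m≡kd =
  *-cancelˡ-< 2 k m (subst (2 * k <_) (sym 2m≡kd) (2*m<m*n 0<k 3≤d))

cofactor≤half : ∀ {k d m} → 0 < k → 3 ≤ d → 1 + 2 * m ≡ k * d → k ≤ m
cofactor≤half {k} {d} {m} 0<k 3≤d 1+2m≡kd =
  *-cancelˡ-≤ 2 (≤-pred (subst (2 * k <_) (sym 1+2m≡kd) (2*m<m*n 0<k 3≤d)))

private
  excess-count : ∀ e → 2 * (3 + e) ≡ 4 + (2 + e * 2)
  excess-count = solve-∀

  excess-mass : ∀ k e → (2 + e * 2) * k + k * 4 ≡ 2 * (k * (3 + e))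
  excess-mass = solve-∀

  even-mass : ∀ k n → 2 * (2 * (k + n)) ≡ n + (n + (n + (n + 0))) + k * 4
  even-mass = solve-∀

  odd-mass : ∀ k n → 2 * (1 + 2 * (k + n)) ≡ suc n + (suc n + (n + (n + 0))) + k * 4
  odd-mass = solve-∀

  even-point : ∀ y → y + (y + (1 + 0)) ≡ y + suc (y + 0)
  even-point = solve-∀

  odd-point : ∀ y → suc y + (y + (1 + 0)) ≡ 2 * suc y
  odd-point = solve-∀

prod-replicate-innerBinom-<-even : ∀ {k d m p} → 0 < k → 3 ≤ d → p ≡ k * d → p ≡ 2 * m →
  prod (replicate (2 * d) (innerBinom k)) p < prod (replicate 4 (innerBinom m)) p
prod-replicate-innerBinom-<-even {k@(suc k′)} {d@(suc (suc (suc e)))} {m}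
                                 0<k 3≤d@(s≤s (s≤s (s≤s _))) 2m≡kd refl
  with m≤n⇒∃[o]m+o≡n {k} {m} (<⇒≤ (cofactor<half 0<k 3≤d 2m≡kd))
... | n , refl =
  subst (λ c → prod (replicate c (innerBinom k)) (2 * (k + n))
                 < prod (replicate 4 (innerBinom (k + n))) (2 * (k + n)))
        (sym (excess-count e))
        (prod-replicate-innerBinom-< {k} {2 + e * 2} {n} (n ∷ n ∷ n ∷ []) {y + suc (y + 0)}
           0<k 0<n N*k≡4n rest-pos)
  where
  y = k′ + n
  0<n : 0 < n
  0<n = +-cancelˡ-< k 0 n (subst (_< k + n) (sym (+-identityʳ k)) (cofactor<half 0<k 3≤d 2m≡kd))
  N*k≡4n : (2 + e * 2) * k ≡ n + (n + (n + (n + 0)))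
  N*k≡4n = +-cancelʳ-≡ (k * 4) _ _ (begin
    (2 + e * 2) * k + k * 4         ≡⟨ excess-mass k e ⟩
    2 * (k * d)                     ≡⟨ cong (2 *_) 2m≡kd ⟨
    2 * (2 * (k + n))               ≡⟨ even-mass k n ⟩
    n + (n + (n + (n + 0))) + k * 4 ∎)
    where open ≡-Reasoning
  0<y : 0 < y
  0<y = ≤-trans 0<n (m≤n+m n k′)
  rest = replicate 3 (innerBinom (k + n))
  rest-pos : 0 < prod rest (y + suc (y + 0))
  rest-pos = subst (λ u → 0 < prod rest u) (even-point y)
    (prod-pos {rest} {y ∷ y ∷ 1 ∷ []}
       (innerBinom-pos 0<y ≤-refl ∷ innerBinom-pos 0<y ≤-refl ∷ innerBinom-pos z<s (s≤s 0<y) ∷ []))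

prod-replicate-innerBinom-<-odd : ∀ {k d x p} → 0 < k → 3 ≤ d → 2 ≤ x →
  p ≡ k * d → p ≡ 1 + 2 * x →
  prod (replicate (2 * d) (innerBinom k)) p
    < prod (innerBinom (suc x) ∷ innerBinom (suc x) ∷ innerBinom x ∷ innerBinom x ∷ []) p
prod-replicate-innerBinom-<-odd {k@(suc k′)} {d@(suc (suc (suc e)))} {x}
                                0<k 3≤d@(s≤s (s≤s (s≤s _))) 2≤x 1+2x≡kd refl
  with m≤n⇒∃[o]m+o≡n {k} {x} (cofactor≤half 0<k 3≤d 1+2x≡kd)
... | n , refl =
  subst₂ (λ c z → prod (replicate c (innerBinom k)) (1 + 2 * (k + n))
                    < prod (innerBinom z ∷ innerBinom z ∷ innerBinom (k + n) ∷ innerBinom (k + n) ∷ [])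
                           (1 + 2 * (k + n)))
         (sym (excess-count e)) (+-suc k n)
         (prod-replicate-innerBinom-< {k} {2 + e * 2} {suc n} (suc n ∷ n ∷ n ∷ []) {2 * (k + n)}
            0<k z<s N*k≡2+4n rest-pos)
  where
  y = k′ + n
  N*k≡2+4n : (2 + e * 2) * k ≡ suc n + (suc n + (n + (n + 0)))
  N*k≡2+4n = +-cancelʳ-≡ (k * 4) _ _ (begin
    (2 + e * 2) * k + k * 4                 ≡⟨ excess-mass k e ⟩
    2 * (k * d)                             ≡⟨ cong (2 *_) 1+2x≡kd ⟨
    2 * (1 + 2 * (k + n))                   ≡⟨ odd-mass k n ⟩
    suc n + (suc n + (n + (n + 0))) + k * 4 ∎)
    where open ≡-Reasoning
  0<y : 0 < y
  0<y = ≤-pred 2≤x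
  rest = innerBinom (k + suc n) ∷ innerBinom (k + n) ∷ innerBinom (k + n) ∷ []
  rest-pos : 0 < prod rest (2 * (k + n))
  rest-pos = subst (λ u → 0 < prod rest u) (odd-point y)
    (prod-pos {rest} {suc y ∷ y ∷ 1 ∷ []} (innerBinom-pos z<s (s≤s (≤-reflexive (sym (+-suc k′ n))))
             ∷ innerBinom-pos 0<y ≤-refl ∷ innerBinom-pos z<s (s≤s 0<y) ∷ []))

Φ*≡prod : ∀ p d .{{_ : NonZero d}} → Φ* p d ≡ prod (replicate (2 * d) (innerBinom (p / d))) p
Φ*≡prod p d = trans (tupleSum≗prod (replicate (2 * d) (p / d , 1 , p / d ∸ 1)) p)
                    (cong (λ fs → prod fs p) (map-replicate slotSeq (2 * d) (p / d , 1 , p / d ∸ 1)))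

Φodd≡prod : ∀ p → let x = p / 2 in
  Φodd p ≡ prod (innerBinom (suc x) ∷ innerBinom (suc x) ∷ innerBinom x ∷ innerBinom x ∷ []) p
Φodd≡prod p =
  trans (tupleSum≗prod ((x + 1 , 1 , x) ∷ (x + 1 , 1 , x) ∷ (x , 1 , x ∸ 1) ∷ (x , 1 , x ∸ 1) ∷ []) p)
        (cong (λ z → prod (slotSeq (z , 1 , x) ∷ slotSeq (z , 1 , x) ∷ innerBinom x ∷ innerBinom x ∷ []) p)
              (+-comm x 1))
  where x = p / 2

proposition3p10 : (p : ℕ) → 4 ≤ p → Composite p →
    (d : ℕ) .{{_ : NonZero d}} → d ∣ p → 3 ≤ d → d < p →
      (p % 2 ≡ 0 → Φ* p d < Φeven p) × (p % 2 ≡ 1 → Φ* p d < Φodd p)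
proposition3p10 p 4≤p _ d (divides k p≡kd) 3≤d _ = even , odd
  where
  0<k : 0 < k
  0<k = cofactor-pos (≤-trans z<s 4≤p) p≡kd
  Φ*≡ : Φ* p d ≡ prod (replicate (2 * d) (innerBinom k)) p
  Φ*≡ = trans (Φ*≡prod p d)
              (cong (λ c → prod (replicate (2 * d) (innerBinom c)) p) (trans (cong (_/ d) p≡kd) (m*n/n≡m k d)))
  p≡r+2x : p ≡ p % 2 + 2 * (p / 2)
  p≡r+2x = trans (m≡m%n+[m/n]*n p 2) (cong (p % 2 +_) (*-comm (p / 2) 2))
  even : p % 2 ≡ 0 → Φ* p d < Φeven p
  even p%2≡0 = subst₂ _<_ (sym Φ*≡) (sym (Φ*≡prod p 2))
    (prod-replicate-innerBinom-<-even {m = p / 2} 0<k 3≤d p≡kd (trans p≡r+2x (cong (_+ 2 * (p / 2)) p%2≡0)))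
  odd : p % 2 ≡ 1 → Φ* p d < Φodd p
  odd p%2≡1 = subst₂ _<_ (sym Φ*≡) (sym (Φodd≡prod p))
    (prod-replicate-innerBinom-<-odd {x = p / 2} 0<k 3≤d (/-monoˡ-≤ 2 4≤p) p≡kd
       (trans p≡r+2x (cong (_+ 2 * (p / 2)) p%2≡1)))
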